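{- There is a relational signature $\sigma$ and a sequence $(\phi_h)_{h\geq 1}$ of first-order sentences over $\sigma$ of size $O(h)$ such that for each $h\geq 1$, every sentence in Barthelmann-Schwentick normal form that is equivalent to $\phi_h$ on all $\sigma$-structures of degree $\leq 2$ has size $>2^{2^h+1}$.
   Context: Structures are finite with non-empty universe; the degree of a structure is the maximum degree of its Gaifman graph (vertices the elements, edges between distinct elements occurring together in some tuple of some relation). The size of a formula is its length as a word. A formula $\phi(\overline{y},z)$ is $r$-local around $z$ if for every structure $\mathcal{A}$ and all tuples, $\mathcal{A}\models\phi[\overline{a},c]$ iff $\mathcal{A}[\{\text{entries of }\overline{a}\}\cup N_r^{\mathcal{A}}(c)]\models\phi[\overline{a},c]$, where $N_r^{\mathcal{A}}(c)$ is the set of elements at Gaifman distance $\leq r$ from $c$. A sentence is in Barthelmann-Schwentick normal form if it has the form $\exists y_1\cdots\exists y_n\forall z\,\phi(y_1,\dots,y_n,z)$ with $n\ge0$ and $\phi$ $r$-local around $z$ for some $r\geq0$. -}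

module Defs where

open import Data.Nat using (ℕ; zero; suc; _+_; _*_; _^_; _≤_; _<_)
open import Data.Fin using (Fin; zero; suc)
open import Data.Vec using (Vec; map; length)
open import Data.Vec.Membership.Propositional using (_∈_)
open import Data.Product using (Σ; ∃; _×_; _,_)
open import Data.Sum using (_⊎_; inj₁; inj₂)
open import Data.Empty using (⊥)
open import Relation.Nullary using (¬_)
open import Relation.Binary.PropositionalEquality using (_≡_; _≢_; refl)
open import Function.Bundles using (_↔_; _⇔_)
open import Function.Definitions using (Injective)

record Signature : Set where
  field
    nRel : ℕ
    arity : Fin nRel → ℕ
open Signature public

-- First-order formulas over σ, de Bruijn style: Formula σ m has its
-- free variables among Fin m.  Variable 0 is the most recently bound.

data Formula (σ : Signature) : ℕ → Set where
  atom : ∀ {m} (R : Fin (nRel σ)) → Vec (Fin m) (arity σ R) → Formula σ m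
  equal : ∀ {m} → Fin m → Fin m → Formula σ m
  neg : ∀ {m} → Formula σ m → Formula σ m
  and : ∀ {m} → Formula σ m → Formula σ m → Formula σ m
  or : ∀ {m} → Formula σ m → Formula σ m → Formula σ m
  ex : ∀ {m} → Formula σ (suc m) → Formula σ m
  all : ∀ {m} → Formula σ (suc m) → Formula σ m

Sentence : Signature → Set
Sentence σ = Formula σ 0

-- Size = length as a word, each symbol (relation symbol, variable,
-- =, ¬, ∧, ∨, ∃, ∀, parenthesis) counting 1:
--   R x1..xk : 1 + k,   x = y : 3,   ¬φ : 1 + |φ|,
--   (φ ∧ ψ), (φ ∨ ψ) : 3 + |φ| + |ψ|,   ∃x φ, ∀x φ : 2 + |φ|.
size : ∀ {σ m} → Formula σ m → ℕ
size (atom R xs) = suc (length xs)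
size (equal x y) = 3
size (neg φ) = suc (size φ)
size (and φ ψ) = 3 + size φ + size ψ
size (or φ ψ) = 3 + size φ + size ψ
size (ex φ) = 2 + size φ
size (all φ) = 2 + size φ

record Structure (σ : Signature) : Set₁ where
  field
    Carrier : Set
    rel : (R : Fin (nRel σ)) → Vec Carrier (arity σ R) → Set
open Structure public

FiniteNonEmpty : ∀ {σ} → Structure σ → Set
FiniteNonEmpty 𝔄 = ∃ λ n → Carrier 𝔄 ↔ Fin (suc n)

_∷ₐ_ : ∀ {A : Set} {m} → A → (Fin m → A) → Fin (suc m) → A
(a ∷ₐ ρ) zero = a
(a ∷ₐ ρ) (suc i) = ρ i

Sat : ∀ {σ m} (𝔄 : Structure σ) → Formula σ m → (Fin m → Carrier 𝔄) → Set
Sat 𝔄 (atom R xs) ρ = rel 𝔄 R (map ρ xs)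
Sat 𝔄 (equal x y) ρ = ρ x ≡ ρ y
Sat 𝔄 (neg φ) ρ = ¬ Sat 𝔄 φ ρ
Sat 𝔄 (and φ ψ) ρ = Sat 𝔄 φ ρ × Sat 𝔄 ψ ρ
Sat 𝔄 (or φ ψ) ρ = Sat 𝔄 φ ρ ⊎ Sat 𝔄 ψ ρ
Sat 𝔄 (ex φ) ρ = Σ (Carrier 𝔄) λ a → Sat 𝔄 φ (a ∷ₐ ρ)
Sat 𝔄 (all φ) ρ = (a : Carrier 𝔄) → Sat 𝔄 φ (a ∷ₐ ρ)

∅ : ∀ {A : Set} → Fin 0 → A
∅ ()

Adj : ∀ {σ} (𝔄 : Structure σ) → Carrier 𝔄 → Carrier 𝔄 → Set
Adj {σ} 𝔄 a b = a ≢ b × Σ (Fin (nRel σ)) λ R → Σ (Vec (Carrier 𝔄) (arity σ R)) λ t →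
  rel 𝔄 R t × a ∈ t × b ∈ t

Near : ∀ {σ} (𝔄 : Structure σ) → ℕ → Carrier 𝔄 → Carrier 𝔄 → Set
Near 𝔄 zero a b = a ≡ b
Near 𝔄 (suc r) a b = a ≡ b ⊎ Σ (Carrier 𝔄) λ c → Adj 𝔄 a c × Near 𝔄 r c b

near-refl : ∀ {σ} (𝔄 : Structure σ) r a → Near 𝔄 r a a
near-refl 𝔄 zero a = refl
near-refl 𝔄 (suc r) a = inj₁ refl

DegreeAtMost : ∀ {σ} → ℕ → Structure σ → Set
DegreeAtMost d 𝔄 = (a : Carrier 𝔄) (f : Fin (suc d) → Carrier 𝔄) →
  Injective _≡_ _≡_ f → ((i : Fin (suc d)) → Adj 𝔄 a (f i)) → ⊥

-- Induced substructure on a subset P (irrelevant membership proof, so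
-- elements are determined by their underlying element).

record Sub (A : Set) (P : A → Set) : Set where
  constructor ⟨_,_⟩
  field
    elt : A
    .prf : P elt
open Sub public

Induced : ∀ {σ} (𝔄 : Structure σ) → (Carrier 𝔄 → Set) → Structure σ
Induced 𝔄 P = record
  { Carrier = Sub (Carrier 𝔄) P
  ; rel = λ R t → rel 𝔄 R (map elt t) }

-- Locality.  φ(y1,…,yn,z) : Formula σ (suc n), where variable 0 is z
-- and variables suc i (i : Fin n) are the y's.

LocalSet : ∀ {σ n} (𝔄 : Structure σ) (r : ℕ) → (Fin (suc n) → Carrier 𝔄) →
  Carrier 𝔄 → Set
LocalSet {n = n} 𝔄 r ρ a = (Σ (Fin n) λ i → a ≡ ρ (suc i)) ⊎ Near 𝔄 r (ρ zero) a

restrict : ∀ {σ n} (𝔄 : Structure σ) (r : ℕ) (ρ : Fin (suc n) → Carrier 𝔄) →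
  Fin (suc n) → Carrier (Induced 𝔄 (LocalSet 𝔄 r ρ))
restrict 𝔄 r ρ zero = ⟨ ρ zero , inj₂ (near-refl 𝔄 r (ρ zero)) ⟩
restrict 𝔄 r ρ (suc i) = ⟨ ρ (suc i) , inj₁ (i , refl) ⟩

IsLocal : ∀ {σ n} → ℕ → Formula σ (suc n) → Set₁
IsLocal {σ} r φ = (𝔄 : Structure σ) → FiniteNonEmpty 𝔄 →
  (ρ : Fin _ → Carrier 𝔄) →
  Sat 𝔄 φ ρ ⇔ Sat (Induced 𝔄 (LocalSet 𝔄 r ρ)) φ (restrict 𝔄 r ρ)

exs : ∀ {σ} n → Formula σ n → Sentence σ
exs zero ψ = ψ
exs (suc n) ψ = exs n (ex ψ)

BSNF : ∀ {σ} → Sentence σ → Set₁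
BSNF {σ} θ = Σ ℕ λ n → Σ (Formula σ (suc n)) λ φ →
  θ ≡ exs n (all φ) × Σ ℕ λ r → IsLocal r φ

EquivOnDegree : ∀ {σ} → ℕ → Sentence σ → Sentence σ → Set₁
EquivOnDegree {σ} d φ ψ = (𝔄 : Structure σ) → FiniteNonEmpty 𝔄 → DegreeAtMost d 𝔄 →
  Sat 𝔄 φ ∅ ⇔ Sat 𝔄 ψ ∅

{-# OPTIONS --safe #-}

-- Let L = 2^h. The sentence noTwins h says that no two distinct nodes start walks
-- of length L carrying the same colours. The disjoint union 𝔄 of one coloured path
-- with L edges for each of the 2^(L+1) colourings has degree 2 and satisfies it;
-- adding a second copy of the path of a word w violates it. Now let ∃y₁⋯∃yₙ∀z φ,
-- with φ local around z, hold in 𝔄 with witnesses none of which lies on the path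
-- of w. After adding the copy, every node z is hit by an embedding of 𝔄 onto a
-- union of components that fixes the witnesses, and such an embedding maps the
-- local neighbourhood of the witnesses and z isomorphically; so the same witnesses
-- still work. Hence an equivalent sentence in this normal form needs n ≥ 2^(L+1).

module Submission where

open import Defs
open import Data.Bool using (Bool; true; false)
import Data.Bool.Properties as Bool
open import Data.Empty using (⊥-elim)
open import Data.Fin using (Fin; zero; suc; toℕ; fromℕ; fromℕ<; #_; _↑ʳ_)
import Data.Fin.Properties as Fin
open import Data.Maybe using (Maybe; just; nothing; fromMaybe)
import Data.Maybe.Properties as Maybe
open import Data.Nat using (ℕ; zero; suc; _+_; _*_; _^_; _≤_; _<_; _≤?_; s≤s; s≤s⁻¹; z≤n; z<s)
open import Data.Nat.Properties
open import Data.Product using (Σ; _×_; _,_; proj₁; proj₂; map₁; map₂)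
open import Data.Product.Function.NonDependent.Propositional using (_×-⇔_; _×-↔_)
import Data.Product.Properties as Product
open import Data.Sum using (_⊎_; inj₁; inj₂) renaming (map to ⊎-map)
open import Data.Sum.Function.Propositional using (_⊎-⇔_)
open import Data.Vec using (Vec; []; _∷_; map; lookup; replicate; uncons)
open import Data.Vec.Membership.Propositional using (_∈_)
open import Data.Vec.Membership.Propositional.Properties using (∈-map⁺)
import Data.Vec.Properties as Vec
open import Data.Vec.Relation.Unary.Any using (here; there)
open import Function using (_∘_; id)
open import Function.Bundles using (_↔_; _⇔_; mk⇔; mk↔ₛ′; Equivalence; Inverse)
open import Function.Definitions using (Injective)
open import Function.Properties.Inverse using (↔-refl; ↔-sym; ↔-trans)
open import Function.Related.TypeIsomorphisms using (¬-cong-⇔)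
open import Relation.Binary.Definitions using (DecidableEquality)
open import Relation.Binary.PropositionalEquality
  using (_≡_; _≢_; _≗_; refl; sym; trans; cong; cong₂; subst; module ≡-Reasoning)
open import Relation.Nullary using (¬_; Dec; yes; no; recompute)
open import Relation.Nullary.Decidable using (_×-dec_; _⊎-dec_)

¬⊎⇒→ : ∀ {A B : Set} → ¬ A ⊎ B → A → B
¬⊎⇒→ (inj₁ ¬a) a = ⊥-elim (¬a a)
¬⊎⇒→ (inj₂ b) _ = b

→⇒¬⊎ : ∀ {A B : Set} → Dec A → (A → B) → ¬ A ⊎ B
→⇒¬⊎ (yes a) f = inj₂ (f a)
→⇒¬⊎ (no ¬a) _ = inj₁ ¬a

∘-∷ₐ : ∀ {A B : Set} {m} (f : A → B) (a : A) (ρ : Fin m → A) → f ∘ (a ∷ₐ ρ) ≗ (f a ∷ₐ (f ∘ ρ))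
∘-∷ₐ f a ρ zero = refl
∘-∷ₐ f a ρ (suc i) = refl

∷ₐ-η : ∀ {A : Set} {m} (ρ : Fin (suc m) → A) → ρ ≗ (ρ zero ∷ₐ (ρ ∘ suc))
∷ₐ-η ρ zero = refl
∷ₐ-η ρ (suc i) = refl

∷ₐ-cong : ∀ {A : Set} {m} {a b : A} {ρ ρ' : Fin m → A} → a ≡ b → ρ ≗ ρ' → (a ∷ₐ ρ) ≗ (b ∷ₐ ρ')
∷ₐ-cong a≡b ρ≗ρ' zero = a≡b
∷ₐ-cong a≡b ρ≗ρ' (suc i) = ρ≗ρ' i

Sat-cong : ∀ {σ m} (𝔄 : Structure σ) (φ : Formula σ m) {ρ ρ' : Fin m → Carrier 𝔄} →
  ρ ≗ ρ' → Sat 𝔄 φ ρ → Sat 𝔄 φ ρ'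
Sat-cong 𝔄 (atom R xs) ρ≗ρ' = subst (rel 𝔄 R) (Vec.map-cong ρ≗ρ' xs)
Sat-cong 𝔄 (equal x y) ρ≗ρ' e = trans (sym (ρ≗ρ' x)) (trans e (ρ≗ρ' y))
Sat-cong 𝔄 (neg φ) ρ≗ρ' ¬s = ¬s ∘ Sat-cong 𝔄 φ (sym ∘ ρ≗ρ')
Sat-cong 𝔄 (and φ ψ) ρ≗ρ' (s , t) = Sat-cong 𝔄 φ ρ≗ρ' s , Sat-cong 𝔄 ψ ρ≗ρ' t
Sat-cong 𝔄 (or φ ψ) ρ≗ρ' (inj₁ s) = inj₁ (Sat-cong 𝔄 φ ρ≗ρ' s)
Sat-cong 𝔄 (or φ ψ) ρ≗ρ' (inj₂ t) = inj₂ (Sat-cong 𝔄 ψ ρ≗ρ' t)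
Sat-cong 𝔄 (ex φ) ρ≗ρ' (a , s) = a , Sat-cong 𝔄 φ (∷ₐ-cong refl ρ≗ρ') s
Sat-cong 𝔄 (all φ) ρ≗ρ' s a = Sat-cong 𝔄 φ (∷ₐ-cong refl ρ≗ρ') (s a)

Sat-exs⁻ : ∀ {σ} (𝔄 : Structure σ) n (ψ : Formula σ n) →
  Sat 𝔄 (exs n ψ) ∅ → Σ (Fin n → Carrier 𝔄) (Sat 𝔄 ψ)
Sat-exs⁻ 𝔄 zero ψ s = ∅ , s
Sat-exs⁻ 𝔄 (suc n) ψ s = let ρ , a , t = Sat-exs⁻ 𝔄 n (ex ψ) s in a ∷ₐ ρ , t

Sat-exs⁺ : ∀ {σ} (𝔄 : Structure σ) n (ψ : Formula σ n) (ρ : Fin n → Carrier 𝔄) →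
  Sat 𝔄 ψ ρ → Sat 𝔄 (exs n ψ) ∅
Sat-exs⁺ 𝔄 zero ψ ρ s = Sat-cong 𝔄 ψ (λ ()) s
Sat-exs⁺ 𝔄 (suc n) ψ ρ s = Sat-exs⁺ 𝔄 n (ex ψ) (ρ ∘ suc) (ρ zero , Sat-cong 𝔄 ψ (∷ₐ-η ρ) s)

size-exs : ∀ {σ} n (ψ : Formula σ n) → n + size ψ ≤ size (exs n ψ)
size-exs zero ψ = ≤-refl
size-exs (suc n) ψ = begin
  suc n + size ψ      ≡⟨ +-suc n (size ψ) ⟨
  n + suc (size ψ)    ≤⟨ +-monoʳ-≤ n (n≤1+n _) ⟩
  n + size (ex ψ)     ≤⟨ size-exs n (ex ψ) ⟩
  size (exs n (ex ψ)) ∎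
  where open ≤-Reasoning

-- Isomorphisms, component embeddings and locality

record _≅_ {σ} (𝔄 𝔅 : Structure σ) : Set where
  field
    to : Carrier 𝔄 → Carrier 𝔅
    from : Carrier 𝔅 → Carrier 𝔄
    from∘to : ∀ a → from (to a) ≡ a
    to∘from : ∀ b → to (from b) ≡ b
    to-hom : ∀ R t → rel 𝔄 R t → rel 𝔅 R (map to t)
    from-hom : ∀ R t → rel 𝔅 R t → rel 𝔄 R (map from t)

module _ {σ} {𝔄 𝔅 : Structure σ} (iso : 𝔄 ≅ 𝔅) where
  open _≅_ iso

  to∘from-∷ₐ : ∀ {m} b (ρ : Fin m → Carrier 𝔄) → to ∘ (from b ∷ₐ ρ) ≗ (b ∷ₐ (to ∘ ρ))
  to∘from-∷ₐ b ρ zero = to∘from b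
  to∘from-∷ₐ b ρ (suc i) = refl

  Sat-≅ : ∀ {m} (φ : Formula σ m) (ρ : Fin m → Carrier 𝔄) → Sat 𝔄 φ ρ ⇔ Sat 𝔅 φ (to ∘ ρ)
  Sat-≅ (atom R xs) ρ = mk⇔
    (λ r → subst (rel 𝔅 R) (sym (Vec.map-∘ to ρ xs)) (to-hom R _ r))
    (λ r → subst (rel 𝔄 R) from-to-ρ (from-hom R _ r))
    where
    from-to-ρ : map from (map (to ∘ ρ) xs) ≡ map ρ xs
    from-to-ρ = trans (sym (Vec.map-∘ from (to ∘ ρ) xs)) (Vec.map-cong (from∘to ∘ ρ) xs)
  Sat-≅ (equal x y) ρ = mk⇔ (cong to) (λ e → trans (sym (from∘to _)) (trans (cong from e) (from∘to _)))
  Sat-≅ (neg φ) ρ = ¬-cong-⇔ (Sat-≅ φ ρ)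
  Sat-≅ (and φ ψ) ρ = Sat-≅ φ ρ ×-⇔ Sat-≅ ψ ρ
  Sat-≅ (or φ ψ) ρ = Sat-≅ φ ρ ⊎-⇔ Sat-≅ ψ ρ
  Sat-≅ (ex φ) ρ = mk⇔
    (λ (a , s) → to a , Sat-cong 𝔅 φ (∘-∷ₐ to a ρ) (Equivalence.to (Sat-≅ φ (a ∷ₐ ρ)) s))
    (λ (b , s) → from b , Equivalence.from (Sat-≅ φ (from b ∷ₐ ρ)) (Sat-cong 𝔅 φ (sym ∘ to∘from-∷ₐ b ρ) s))
  Sat-≅ (all φ) ρ = mk⇔
    (λ s b → Sat-cong 𝔅 φ (to∘from-∷ₐ b ρ) (Equivalence.to (Sat-≅ φ (from b ∷ₐ ρ)) (s (from b))))
    (λ s a → Equivalence.from (Sat-≅ φ (a ∷ₐ ρ)) (Sat-cong 𝔅 φ (sym ∘ ∘-∷ₐ to a ρ) (s (to a))))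

Sub-≡ : ∀ {A : Set} {P : A → Set} {s s' : Sub A P} → elt s ≡ elt s' → s ≡ s'
Sub-≡ {s = ⟨ a , _ ⟩} {⟨ .a , _ ⟩} refl = refl

record ComponentEmbedding {σ} (𝔄 𝔅 : Structure σ) : Set where
  field
    embed : Carrier 𝔄 → Carrier 𝔅
    retract : Carrier 𝔅 → Carrier 𝔄
    retract∘embed : ∀ a → retract (embed a) ≡ a
    embed-hom : ∀ R t → rel 𝔄 R t → rel 𝔅 R (map embed t)
    retract-hom : ∀ R t → rel 𝔅 R t → rel 𝔄 R (map retract t)
    image-closed : ∀ {a b} → Adj 𝔅 (embed a) b → embed (retract b) ≡ b

module _ {σ} {𝔄 𝔅 : Structure σ} (e : ComponentEmbedding 𝔄 𝔅) where
  open ComponentEmbedding e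

  retract-image : ∀ {a b} → embed a ≡ b → retract b ≡ a
  retract-image {a} refl = retract∘embed a

  embed-retract-image : ∀ {a b} → embed a ≡ b → embed (retract b) ≡ b
  embed-retract-image {a} refl = cong embed (retract∘embed a)

  embed-injective : ∀ {a a'} → embed a ≡ embed a' → a ≡ a'
  embed-injective {a} e = trans (sym (retract∘embed a)) (retract-image (sym e))

  Adj-embed : ∀ {a a'} → Adj 𝔄 a a' → Adj 𝔅 (embed a) (embed a')
  Adj-embed (a≢a' , R , t , r , a∈t , a'∈t) =
    a≢a' ∘ embed-injective , R , map embed t , embed-hom R t r , ∈-map⁺ embed a∈t , ∈-map⁺ embed a'∈t

  Adj-retract : ∀ {a b} → Adj 𝔅 (embed a) b → Adj 𝔄 a (retract b)
  Adj-retract {a} adj@(a≢b , R , t , r , a∈t , b∈t) =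
    (λ a≡b → a≢b (trans (cong embed a≡b) (image-closed adj))) , R , map retract t , retract-hom R t r ,
    subst (_∈ map retract t) (retract∘embed a) (∈-map⁺ retract a∈t) , ∈-map⁺ retract b∈t

  Near-embed : ∀ r {a a'} → Near 𝔄 r a a' → Near 𝔅 r (embed a) (embed a')
  Near-embed zero a≡a' = cong embed a≡a'
  Near-embed (suc r) (inj₁ a≡a') = inj₁ (cong embed a≡a')
  Near-embed (suc r) (inj₂ (c , adj , near)) = inj₂ (embed c , Adj-embed adj , Near-embed r near)

  Near-embed⁻ : ∀ r {a b} → Near 𝔅 r (embed a) b → Σ (Carrier 𝔄) λ a' → embed a' ≡ b × Near 𝔄 r a a'
  Near-embed⁻ zero {a} a≡b = a , a≡b , refl
  Near-embed⁻ (suc r) {a} (inj₁ a≡b) = a , a≡b , inj₁ refl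
  Near-embed⁻ (suc r) {b = b} (inj₂ (c , adj , near)) =
    let a' , a'≡b , near' = Near-embed⁻ r (subst (λ x → Near 𝔅 r x b) (sym (image-closed adj)) near)
    in a' , a'≡b , inj₂ (retract c , Adj-retract adj , near')

  module _ {n} (r : ℕ) (ρ : Fin (suc n) → Carrier 𝔄) where

    LocalSet-embed : ∀ {a} → LocalSet 𝔄 r ρ a → LocalSet 𝔅 r (embed ∘ ρ) (embed a)
    LocalSet-embed (inj₁ (i , a≡ρi)) = inj₁ (i , cong embed a≡ρi)
    LocalSet-embed (inj₂ near) = inj₂ (Near-embed r near)

    LocalSet-embed⁻ : ∀ {b} → LocalSet 𝔅 r (embed ∘ ρ) b →
      Σ (Carrier 𝔄) λ a → embed a ≡ b × LocalSet 𝔄 r ρ a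
    LocalSet-embed⁻ (inj₁ (i , b≡ρi)) = ρ (suc i) , sym b≡ρi , inj₁ (i , refl)
    LocalSet-embed⁻ (inj₂ near) = map₂ (map₂ inj₂) (Near-embed⁻ r near)

    retract-LocalSet : ∀ {b} → LocalSet 𝔅 r (embed ∘ ρ) b → LocalSet 𝔄 r ρ (retract b)
    retract-LocalSet q = let a , a≡b , p = LocalSet-embed⁻ q in
      subst (LocalSet 𝔄 r ρ) (sym (retract-image a≡b)) p

    -- Membership proofs of induced substructures are irrelevant, so the equation
    -- embed (retract b) ≡ b is recomputed from a decision procedure.
    Induced-LocalSet-≅ : DecidableEquality (Carrier 𝔅) →
      Induced 𝔄 (LocalSet 𝔄 r ρ) ≅ Induced 𝔅 (LocalSet 𝔅 r (embed ∘ ρ))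
    Induced-LocalSet-≅ _≟_ = record
      { to = embedₗ
      ; from = retractₗ
      ; from∘to = λ s → Sub-≡ (retract∘embed (elt s))
      ; to∘from = λ { ⟨ b , q ⟩ → Sub-≡ (recompute (embed (retract b) ≟ b)
          (let _ , a≡b , _ = LocalSet-embed⁻ q in embed-retract-image a≡b)) }
      ; to-hom = λ R t → subst (rel 𝔅 R) (trans (sym (Vec.map-∘ embed elt t)) (Vec.map-∘ elt embedₗ t))
          ∘ embed-hom R _
      ; from-hom = λ R t → subst (rel 𝔄 R) (trans (sym (Vec.map-∘ retract elt t)) (Vec.map-∘ elt retractₗ t))
          ∘ retract-hom R _
      }
      where
      embedₗ : Carrier (Induced 𝔄 (LocalSet 𝔄 r ρ)) → Carrier (Induced 𝔅 (LocalSet 𝔅 r (embed ∘ ρ)))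
      embedₗ ⟨ a , p ⟩ = ⟨ embed a , LocalSet-embed p ⟩
      retractₗ : Carrier (Induced 𝔅 (LocalSet 𝔅 r (embed ∘ ρ))) → Carrier (Induced 𝔄 (LocalSet 𝔄 r ρ))
      retractₗ ⟨ b , q ⟩ = ⟨ retract b , retract-LocalSet q ⟩

  Sat-local-embed : ∀ {n} r (φ : Formula σ (suc n)) → IsLocal r φ →
    FiniteNonEmpty 𝔄 → FiniteNonEmpty 𝔅 → DecidableEquality (Carrier 𝔅) →
    (ρ : Fin (suc n) → Carrier 𝔄) → Sat 𝔄 φ ρ → Sat 𝔅 φ (embed ∘ ρ)
  Sat-local-embed r φ local fin𝔄 fin𝔅 _≟_ ρ =
    Equivalence.from (local 𝔅 fin𝔅 (embed ∘ ρ))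
    ∘ Sat-cong _ φ restrict-embed
    ∘ Equivalence.to (Sat-≅ (Induced-LocalSet-≅ r ρ _≟_) φ (restrict 𝔄 r ρ))
    ∘ Equivalence.to (local 𝔄 fin𝔄 ρ)
    where
    restrict-embed : _≅_.to (Induced-LocalSet-≅ r ρ _≟_) ∘ restrict 𝔄 r ρ ≗ restrict 𝔅 r (embed ∘ ρ)
    restrict-embed zero = refl
    restrict-embed (suc i) = refl

open ComponentEmbedding

Sat-all-local-cover : ∀ {σ n} {𝔄 𝔅 : Structure σ} r (φ : Formula σ (suc n)) → IsLocal r φ →
  FiniteNonEmpty 𝔄 → FiniteNonEmpty 𝔅 → DecidableEquality (Carrier 𝔅) →
  (ρ : Fin n → Carrier 𝔄) (ρ' : Fin n → Carrier 𝔅) →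
  ((b : Carrier 𝔅) → Σ (ComponentEmbedding 𝔄 𝔅) λ e →
    Σ (Carrier 𝔄) λ a → embed e a ≡ b × embed e ∘ ρ ≗ ρ') →
  Sat 𝔄 (all φ) ρ → Sat 𝔅 (all φ) ρ'
Sat-all-local-cover {𝔅 = 𝔅} r φ local fin𝔄 fin𝔅 _≟_ ρ ρ' cover s b =
  let e , a , a↦b , ρ↦ρ' = cover b in
  Sat-cong 𝔅 φ (λ i → trans (∘-∷ₐ (embed e) a ρ i) (∷ₐ-cong a↦b ρ↦ρ' i))
    (Sat-local-embed e r φ local fin𝔄 fin𝔅 _≟_ (a ∷ₐ ρ) (s a))

-- Counting

Vec-↔ : ∀ {A : Set} {k} n → A ↔ Fin k → Vec A n ↔ Fin (k ^ n)
Vec-↔ zero A↔ = mk↔ₛ′ (λ _ → zero) (λ _ → []) (λ { zero → refl }) (λ { [] → refl })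
Vec-↔ (suc n) A↔ = ↔-trans uncons↔ (↔-trans (A↔ ×-↔ Vec-↔ n A↔) (↔-sym Fin.*↔×))
  where
  uncons↔ : Vec _ (suc n) ↔ (_ × Vec _ n)
  uncons↔ = mk↔ₛ′ uncons (λ (x , xs) → x ∷ xs) (λ _ → refl) (λ { (x ∷ xs) → refl })

Maybe-↔ : ∀ {A : Set} {k} → A ↔ Fin k → Maybe A ↔ Fin (suc k)
Maybe-↔ A↔ = mk↔ₛ′
  (λ { nothing → zero ; (just a) → suc (Inverse.to A↔ a) })
  (λ { zero → nothing ; (suc i) → just (Inverse.from A↔ i) })
  (λ { zero → refl ; (suc i) → cong suc (Inverse.strictlyInverseˡ A↔ i) })
  (λ { nothing → refl ; (just a) → cong just (Inverse.strictlyInverseʳ A↔ a) })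

FiniteNonEmpty-↔ : ∀ {σ} {𝔄 : Structure σ} {m} → Carrier 𝔄 ↔ Fin m → Carrier 𝔄 → FiniteNonEmpty 𝔄
FiniteNonEmpty-↔ {m = zero} A↔ a with () ← Inverse.to A↔ a
FiniteNonEmpty-↔ {m = suc k} A↔ a = k , A↔

∃-∉-image : ∀ {A : Set} {m n} → A ↔ Fin m → n < m → (f : Fin n → A) → Σ A λ a → ∀ i → f i ≢ a
∃-∉-image {m = m} A↔ n<m f =
  let k , unhit = Fin.¬∀⟶∃¬ m Hit (λ k → Fin.any? λ i → code i Fin.≟ k) not-all-hit
  in Inverse.from A↔ k , λ i fi≡ → unhit (i , trans (cong (Inverse.to A↔) fi≡) (Inverse.strictlyInverseˡ A↔ k))
  where
  code : Fin _ → Fin m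
  code = Inverse.to A↔ ∘ f
  Hit : Fin m → Set
  Hit k = Σ (Fin _) λ i → code i ≡ k
  not-all-hit : ¬ (∀ k → Hit k)
  not-all-hit hit =
    let i , j , i<j , same = Fin.pigeonhole n<m (proj₁ ∘ hit)
    in Fin.<-irrefl (trans (sym (proj₂ (hit i))) (trans (cong code same) (proj₂ (hit j)))) i<j

DegreeAtMost-labelled : ∀ {σ} {𝔄 : Structure σ} d (label : ∀ {a b} → Adj 𝔄 a b → Fin d) →
  (∀ {a b b'} (adj : Adj 𝔄 a b) (adj' : Adj 𝔄 a b') → label adj ≡ label adj' → b ≡ b') →
  DegreeAtMost d 𝔄
DegreeAtMost-labelled d label label-injective a f f-injective adj =
  let i , j , i<j , same = Fin.pigeonhole (n<1+n d) (label ∘ adj)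
  in Fin.<-irrefl (f-injective (label-injective (adj i) (adj j) same)) i<j

-- The sentences noTwins h

σ-coloured : Signature
σ-coloured = record { nRel = 2 ; arity = λ { zero → 2 ; (suc zero) → 1 } }

edge : ∀ {m} → Fin m → Fin m → Formula σ-coloured m
edge x y = atom zero (x ∷ y ∷ [])

coloured : ∀ {m} → Fin m → Formula σ-coloured m
coloured x = atom (suc zero) (x ∷ [])

_⟺_ : ∀ {σ m} → Formula σ m → Formula σ m → Formula σ m
φ ⟺ ψ = or (and φ ψ) (and (neg φ) (neg ψ))

-- In a disjoint union of coloured paths, twins k x y x' y' says that x' and y' lie
-- 2^k edges ahead of x and y and that the two walks carry the same colours. For
-- k+1 the walks are split at midpoints m, m' and a single copy of twins k handles
-- both halves: under the binders m m' a b a' b' (#5 … #0), halves says that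
-- (a, b, a', b') is (x, y, m, m') or (m, m', x', y'). So the size is linear in k.
halves : ∀ {m} → Fin m → Fin m → Fin m → Fin m → Formula σ-coloured (6 + m)
halves x y x' y' =
  or (and (equal (# 3) (6 ↑ʳ x)) (and (equal (# 2) (6 ↑ʳ y)) (and (equal (# 1) (# 5)) (equal (# 0) (# 4)))))
     (and (equal (# 3) (# 5)) (and (equal (# 2) (# 4)) (and (equal (# 1) (6 ↑ʳ x')) (equal (# 0) (6 ↑ʳ y')))))

twins : ℕ → ∀ {m} → Fin m → Fin m → Fin m → Fin m → Formula σ-coloured m
twins zero x y x' y' =
  and (edge x x') (and (edge y y') (and (coloured x ⟺ coloured y) (coloured x' ⟺ coloured y')))
twins (suc k) x y x' y' =
  ex (ex (all (all (all (all (or (neg (halves x y x' y')) (twins k (# 3) (# 2) (# 1) (# 0))))))))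

noTwins : ℕ → Sentence σ-coloured
noTwins h = all (all (neg (and (neg (equal (# 1) (# 0))) (ex (ex (twins h (# 3) (# 2) (# 1) (# 0)))))))

size-twins : ∀ k {m} (x y x' y' : Fin m) → size (twins k x y x' y') ≡ k * 61 + 53
size-twins zero x y x' y' = refl
size-twins (suc k) x y x' y' = cong (61 +_) (size-twins k _ _ _ _)

size-noTwins : ∀ h → 1 ≤ h → size (noTwins h) ≤ 130 * h
size-noTwins h@(suc _) _ = begin
  size (noTwins h)     ≡⟨ cong (16 +_) (size-twins h (# 3) (# 2) (# 1) (# 0)) ⟩
  16 + (h * 61 + 53)   ≡⟨ +-comm 16 (h * 61 + 53) ⟩
  h * 61 + 53 + 16     ≡⟨ +-assoc (h * 61) 53 16 ⟩
  h * 61 + 69          ≤⟨ +-monoʳ-≤ (h * 61) (m≤n*m 69 h) ⟩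
  h * 61 + h * 69      ≡⟨ *-distribˡ-+ h 61 69 ⟨
  h * 130              ≡⟨ *-comm h 130 ⟩
  130 * h              ∎
  where open ≤-Reasoning

-- Disjoint unions of coloured paths

-- bit v t is the t-th entry of v, and false beyond the end of v.
bit : ∀ {m} → Vec Bool m → ℕ → Bool
bit [] t = false
bit (b ∷ v) zero = b
bit (b ∷ v) (suc t) = bit v t

bit-lookup : ∀ {m} (v : Vec Bool m) i → bit v (toℕ i) ≡ lookup v i
bit-lookup (b ∷ v) zero = refl
bit-lookup (b ∷ v) (suc i) = bit-lookup v i

bit-ext : ∀ {m} (v v' : Vec Bool m) → (∀ t → t < m → bit v t ≡ bit v' t) → v ≡ v'
bit-ext [] [] _ = refl
bit-ext (b ∷ v) (b' ∷ v') same = cong₂ _∷_ (same zero z<s) (bit-ext v v' λ t t<m → same (suc t) (s≤s t<m))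

≤+-split : ∀ d {e t} → t ≤ d + e → t ≤ d ⊎ Σ ℕ λ s → t ≡ d + s × s ≤ e
≤+-split zero t≤e = inj₂ (_ , refl , t≤e)
≤+-split (suc d) {t = zero} _ = inj₁ z≤n
≤+-split (suc d) {t = suc t} (s≤s t≤d+e) = ⊎-map s≤s (map₂ (map₁ (cong suc))) (≤+-split d t≤d+e)

2^suc : ∀ k → 2 ^ suc k ≡ 2 ^ k + 2 ^ k
2^suc k = cong (2 ^ k +_) (+-identityʳ (2 ^ k))

TrueIff : Bool → Bool → Set
TrueIff a b = (a ≡ true × b ≡ true) ⊎ (a ≢ true × b ≢ true)

true-iff⇒≡ : ∀ {a b : Bool} → TrueIff a b → a ≡ b
true-iff⇒≡ {true} {true} _ = refl
true-iff⇒≡ {false} {false} _ = refl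
true-iff⇒≡ {true} {false} (inj₁ (_ , ()))
true-iff⇒≡ {true} {false} (inj₂ (a≢true , _)) = ⊥-elim (a≢true refl)
true-iff⇒≡ {false} {true} (inj₁ (() , _))
true-iff⇒≡ {false} {true} (inj₂ (_ , b≢true)) = ⊥-elim (b≢true refl)

≡⇒true-iff : ∀ {a b : Bool} → a ≡ b → TrueIff a b
≡⇒true-iff {true} refl = inj₁ (refl , refl)
≡⇒true-iff {false} refl = inj₂ ((λ ()) , (λ ()))

module PathsOfLength (L : ℕ) where

  Word : Set
  Word = Vec Bool (suc L)

  Position : Set
  Position = Fin (suc L)

  record Ahead {I : Set} (d : ℕ) (u v : I × Position) : Set where
    constructor ahead
    field
      same-path : proj₁ u ≡ proj₁ v
      offset : toℕ (proj₂ v) ≡ d + toℕ (proj₂ u)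

  module _ {I : Set} where

    Ahead-trans : ∀ {d e} {u v w : I × Position} → Ahead d u v → Ahead e v w → Ahead (e + d) u w
    Ahead-trans {d} {e} {u} (ahead i≡j q≡d+p) (ahead j≡k r≡e+q) =
      ahead (trans i≡j j≡k) (trans r≡e+q (trans (cong (e +_) q≡d+p) (sym (+-assoc e d (toℕ (proj₂ u))))))

    Ahead-functional : ∀ {d} {u v v' : I × Position} → Ahead d u v → Ahead d u v' → v ≡ v'
    Ahead-functional (ahead i≡j q≡) (ahead i≡j' q'≡) =
      Product.×-≡,≡→≡ (trans (sym i≡j) i≡j' , Fin.toℕ-injective (trans q≡ (sym q'≡)))

    Ahead-injective : ∀ {d} {u u' v : I × Position} → Ahead d u v → Ahead d u' v → u ≡ u'
    Ahead-injective {d} (ahead i≡j q≡) (ahead i'≡j q≡') =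
      Product.×-≡,≡→≡ (trans i≡j (sym i'≡j) , Fin.toℕ-injective (+-cancelˡ-≡ d _ _ (trans (sym q≡) q≡')))

    Ahead-from-start : ∀ {u v : I × Position} → Ahead L u v → toℕ (proj₂ u) ≡ 0
    Ahead-from-start {u} {v} (ahead _ q≡L+p) = n≤0⇒n≡0 (+-cancelˡ-≤ L _ 0 (begin
      L + toℕ (proj₂ u) ≡⟨ q≡L+p ⟨
      toℕ (proj₂ v)     ≤⟨ Fin.toℕ≤pred[n] (proj₂ v) ⟩
      L                 ≡⟨ +-identityʳ L ⟨
      L + 0             ∎))
      where open ≤-Reasoning

  midpoint : ∀ k {p p' : Position} → toℕ p' ≡ 2 ^ suc k + toℕ p →
    Σ Position λ q → toℕ q ≡ 2 ^ k + toℕ p × toℕ p' ≡ 2 ^ k + toℕ q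
  midpoint k {p} {p'} p'≡2K+p = fromℕ< K+p<1+L , Fin.toℕ-fromℕ< K+p<1+L , (begin
    toℕ p'                   ≡⟨ p'≡2K+p ⟩
    2 ^ suc k + toℕ p        ≡⟨ cong (_+ toℕ p) (2^suc k) ⟩
    K + K + toℕ p            ≡⟨ +-assoc K K (toℕ p) ⟩
    K + (K + toℕ p)          ≡⟨ cong (K +_) (Fin.toℕ-fromℕ< K+p<1+L) ⟨
    K + toℕ (fromℕ< K+p<1+L) ∎)
    where
    open ≡-Reasoning
    K = 2 ^ k
    K+p<1+L : K + toℕ p < suc L
    K+p<1+L = ≤-<-trans (≤-trans (+-monoˡ-≤ (toℕ p) (m≤m+n K (K + 0))) (≤-reflexive (sym p'≡2K+p)))
                        (Fin.toℕ<n p')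

  module _ {I : Set} (c : I → Word) where

    relPaths : (R : Fin 2) → Vec (I × Position) (arity σ-coloured R) → Set
    relPaths zero (u ∷ v ∷ []) = Ahead 1 u v
    relPaths (suc zero) ((i , p) ∷ []) = lookup (c i) p ≡ true

    Paths : Structure σ-coloured
    Paths = record { Carrier = I × Position ; rel = relPaths }

    Adj-Paths : ∀ {u v} → Adj Paths u v → Ahead 1 u v ⊎ Ahead 1 v u
    Adj-Paths (u≢u , zero , _ ∷ _ ∷ [] , _ , here refl , here refl) = ⊥-elim (u≢u refl)
    Adj-Paths (_ , zero , _ ∷ _ ∷ [] , uv , here refl , there (here refl)) = inj₁ uv
    Adj-Paths (_ , zero , _ ∷ _ ∷ [] , vu , there (here refl) , here refl) = inj₂ vu
    Adj-Paths (u≢u , zero , _ ∷ _ ∷ [] , _ , there (here refl) , there (here refl)) = ⊥-elim (u≢u refl)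
    Adj-Paths (u≢u , suc zero , _ ∷ [] , _ , here refl , here refl) = ⊥-elim (u≢u refl)

    Adj-Paths-component : ∀ {u v} → Adj Paths u v → proj₁ u ≡ proj₁ v
    Adj-Paths-component adj with Adj-Paths adj
    ... | inj₁ uv = Ahead.same-path uv
    ... | inj₂ vu = sym (Ahead.same-path vu)

    Paths-degree≤2 : DegreeAtMost 2 Paths
    Paths-degree≤2 = DegreeAtMost-labelled 2 direction direction-injective
      where
      direction : ∀ {u v} → Adj Paths u v → Fin 2
      direction adj with Adj-Paths adj
      ... | inj₁ _ = zero
      ... | inj₂ _ = suc zero
      direction-injective : ∀ {u v v'} (adj : Adj Paths u v) (adj' : Adj Paths u v') →
        direction adj ≡ direction adj' → v ≡ v'
      direction-injective adj adj' same with Adj-Paths adj | Adj-Paths adj'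
      ... | inj₁ uv | inj₁ uv' = Ahead-functional uv uv'
      ... | inj₂ vu | inj₂ v'u = Ahead-injective vu v'u

    Paths-finite : ∀ {m} → I ↔ Fin m → I → FiniteNonEmpty Paths
    Paths-finite {m} I↔ i =
      FiniteNonEmpty-↔ {𝔄 = Paths} (↔-trans (I↔ ×-↔ ↔-refl) (↔-sym (Fin.*↔× {m} {suc L}))) (i , zero)

    colourAt : I × Position → ℕ → Bool
    colourAt (i , p) t = bit (c i) (t + toℕ p)

    Agree : ℕ → I × Position → I × Position → Set
    Agree d u v = ∀ t → t ≤ d → colourAt u t ≡ colourAt v t

    Twins : ℕ → (u v u' v' : I × Position) → Set
    Twins k u v u' v' = Ahead (2 ^ k) u u' × Ahead (2 ^ k) v v' × Agree (2 ^ k) u v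

    colourAt-Ahead : ∀ {d u u'} → Ahead d u u' → ∀ t → colourAt u (d + t) ≡ colourAt u' t
    colourAt-Ahead {d} {u} {u'} (ahead i≡i' p'≡d+p) t = cong₂ (λ i n → bit (c i) n) i≡i' (begin
      d + t + toℕ (proj₂ u)   ≡⟨ cong (_+ toℕ (proj₂ u)) (+-comm d t) ⟩
      t + d + toℕ (proj₂ u)   ≡⟨ +-assoc t d _ ⟩
      t + (d + toℕ (proj₂ u)) ≡⟨ cong (t +_) p'≡d+p ⟨
      t + toℕ (proj₂ u')      ∎)
      where open ≡-Reasoning

    colourAt-iff : ∀ u v → TrueIff (lookup (c (proj₁ u)) (proj₂ u)) (lookup (c (proj₁ v)) (proj₂ v)) →
      colourAt u 0 ≡ colourAt v 0
    colourAt-iff (i , p) (j , q) iff =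
      trans (bit-lookup (c i) p) (trans (true-iff⇒≡ iff) (sym (bit-lookup (c j) q)))

    Agree-join : ∀ {d e u v m m'} → Agree d u v → Ahead d u m → Ahead d v m' → Agree e m m' →
      Agree (d + e) u v
    Agree-join {d} {u = u} {v} {m} {m'} uv um vm' mm' t t≤d+e with ≤+-split d t≤d+e
    ... | inj₁ t≤d = uv t t≤d
    ... | inj₂ (s , refl , s≤e) = begin
      colourAt u (d + s) ≡⟨ colourAt-Ahead um s ⟩
      colourAt m s       ≡⟨ mm' s s≤e ⟩
      colourAt m' s      ≡⟨ colourAt-Ahead vm' s ⟨
      colourAt v (d + s) ∎
      where open ≡-Reasoning

    Twins-join : ∀ {k u v m m' u' v'} → Twins k u v m m' → Twins k m m' u' v' → Twins (suc k) u v u' v'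
    Twins-join {k} {u} {v} (um , vm' , uv) (mu' , m'v' , mm') =
      double (Ahead-trans um mu') , double (Ahead-trans vm' m'v') ,
      subst (λ d → Agree d u v) (sym (2^suc k)) (Agree-join uv um vm' mm')
      where
      double : ∀ {a b : I × Position} → Ahead (2 ^ k + 2 ^ k) a b → Ahead (2 ^ suc k) a b
      double {a} {b} = subst (λ d → Ahead d a b) (sym (2^suc k))

    twins-sound : ∀ k {m} (x y x' y' : Fin m) (ρ : Fin m → I × Position) →
      Sat Paths (twins k x y x' y') ρ → Twins k (ρ x) (ρ y) (ρ x') (ρ y')
    twins-sound zero x y x' y' ρ (xx' , yy' , xy , x'y') = xx' , yy' , agree
      where
      agree : Agree 1 (ρ x) (ρ y)
      agree zero _ = colourAt-iff (ρ x) (ρ y) xy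
      agree (suc zero) _ = begin
        colourAt (ρ x) 1   ≡⟨ colourAt-Ahead xx' 0 ⟩
        colourAt (ρ x') 0  ≡⟨ colourAt-iff (ρ x') (ρ y') x'y' ⟩
        colourAt (ρ y') 0  ≡⟨ colourAt-Ahead yy' 0 ⟨
        colourAt (ρ y) 1   ∎
        where open ≡-Reasoning
      agree (suc (suc _)) (s≤s ())
    twins-sound (suc k) x y x' y' ρ (m , m' , halves⇒twins) =
      Twins-join {k}
        (twins-sound k _ _ _ _ _ (¬⊎⇒→ (halves⇒twins (ρ x) (ρ y) m m') (inj₁ (refl , refl , refl , refl))))
        (twins-sound k _ _ _ _ _ (¬⊎⇒→ (halves⇒twins m m' (ρ x') (ρ y')) (inj₂ (refl , refl , refl , refl))))

    twins-complete : DecidableEquality I → ∀ k {m} (ρ : Fin m → I × Position) {i j p p'} →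
      c i ≡ c j → toℕ p' ≡ 2 ^ k + toℕ p →
      Sat Paths (twins k (# 3) (# 2) (# 1) (# 0)) ((j , p') ∷ₐ ((i , p') ∷ₐ ((j , p) ∷ₐ ((i , p) ∷ₐ ρ))))
    twins-complete _≟_ zero ρ {i} {j} {p} {p'} ci≡cj p'≡1+p =
      ahead refl p'≡1+p , ahead refl p'≡1+p ,
      ≡⇒true-iff (cong (λ w → lookup w p) ci≡cj) , ≡⇒true-iff (cong (λ w → lookup w p') ci≡cj)
    twins-complete _≟_ (suc k) ρ {i} {j} {p} {p'} ci≡cj p'≡2K+p =
      let q , q≡K+p , p'≡K+q = midpoint k p'≡2K+p in
      (i , q) , (j , q) , λ a b a' b' →
        →⇒¬⊎ ((a ≟ₙ (i , p) ×-dec b ≟ₙ (j , p) ×-dec a' ≟ₙ (i , q) ×-dec b' ≟ₙ (j , q)) ⊎-dec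
              (a ≟ₙ (i , q) ×-dec b ≟ₙ (j , q) ×-dec a' ≟ₙ (i , p') ×-dec b' ≟ₙ (j , p')))
          λ { (inj₁ (refl , refl , refl , refl)) → twins-complete _≟_ k _ ci≡cj q≡K+p
            ; (inj₂ (refl , refl , refl , refl)) → twins-complete _≟_ k _ ci≡cj p'≡K+q }
      where
      _≟ₙ_ : DecidableEquality (I × Position)
      _≟ₙ_ = Product.≡-dec _≟_ Fin._≟_

    colourAt-start : ∀ {u} → toℕ (proj₂ u) ≡ 0 → ∀ t → colourAt u t ≡ bit (c (proj₁ u)) t
    colourAt-start {u} p≡0 t = cong (bit (c (proj₁ u))) (trans (cong (t +_) p≡0) (+-identityʳ t))

    Twins-≡ : ∀ h → L ≡ 2 ^ h → Injective _≡_ _≡_ c → ∀ {u v u' v'} → Twins h u v u' v' → u ≡ v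
    Twins-≡ h L≡2^h c-injective {u} {v} (uu' , vv' , uv) =
      Product.×-≡,≡→≡ (c-injective same-word , Fin.toℕ-injective (trans u-start (sym v-start)))
      where
      u-start : toℕ (proj₂ u) ≡ 0
      u-start = Ahead-from-start (subst (λ d → Ahead d u _) (sym L≡2^h) uu')
      v-start : toℕ (proj₂ v) ≡ 0
      v-start = Ahead-from-start (subst (λ d → Ahead d v _) (sym L≡2^h) vv')
      same-word : c (proj₁ u) ≡ c (proj₁ v)
      same-word = bit-ext _ _ λ t t<1+L →
        trans (sym (colourAt-start u-start t))
          (trans (uv t (subst (t ≤_) L≡2^h (s≤s⁻¹ t<1+L))) (colourAt-start v-start t))

    Paths-noTwins : ∀ h → L ≡ 2 ^ h → Injective _≡_ _≡_ c → Sat Paths (noTwins h) ∅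
    Paths-noTwins h L≡2^h c-injective u v (u≢v , u' , v' , tw) =
      u≢v (Twins-≡ h L≡2^h c-injective (twins-sound h _ _ _ _ _ tw))

    Paths-¬noTwins : DecidableEquality I → ∀ h → L ≡ 2 ^ h → ∀ {i j} → i ≢ j → c i ≡ c j →
      ¬ Sat Paths (noTwins h) ∅
    Paths-¬noTwins _≟_ h L≡2^h {i} {j} i≢j ci≡cj noTwins-holds =
      noTwins-holds (i , zero) (j , zero)
        (i≢j ∘ cong proj₁ , (i , fromℕ L) , (j , fromℕ L) , twins-complete _≟_ h _ ci≡cj end≡2^h)
      where
      end≡2^h : toℕ (fromℕ L) ≡ 2 ^ h + 0
      end≡2^h = trans (Fin.toℕ-fromℕ L) (trans L≡2^h (sym (+-identityʳ _)))

  reindex : ∀ {I J : Set} {c : I → Word} {d : J → Word} (ι : I → J) (κ : J → I) →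
    (∀ i → κ (ι i) ≡ i) → (∀ j → c (κ j) ≡ d j) → ComponentEmbedding (Paths c) (Paths d)
  reindex {c = c} {d} ι κ κ∘ι c∘κ = record
    { embed = map₁ ι
    ; retract = map₁ κ
    ; retract∘embed = λ (i , p) → cong (_, p) (κ∘ι i)
    ; embed-hom = λ
        { zero (_ ∷ _ ∷ []) (ahead i≡j e) → ahead (cong ι i≡j) e
        ; (suc zero) ((i , p) ∷ []) →
            subst (λ w → lookup w p ≡ true) (trans (cong c (sym (κ∘ι i))) (c∘κ (ι i))) }
    ; retract-hom = λ
        { zero (_ ∷ _ ∷ []) (ahead j≡j' e) → ahead (cong κ j≡j') e
        ; (suc zero) ((j , p) ∷ []) → subst (λ w → lookup w p ≡ true) (sym (c∘κ j)) }
    ; image-closed = λ adj → Product.×-≡,≡→≡ (on-image (Adj-Paths-component d adj) , refl)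
    }
    where
    on-image : ∀ {i j} → ι i ≡ j → ι (κ j) ≡ j
    on-image {i} refl = cong ι (κ∘ι i)

-- The lower bound

module _ (h : ℕ) where
  open PathsOfLength (2 ^ h)

  _≟W_ : DecidableEquality Word
  _≟W_ = Vec.≡-dec Bool._≟_

  _≟M_ : DecidableEquality (Maybe Word)
  _≟M_ = Maybe.≡-dec _≟W_

  Word-↔ : Word ↔ Fin (2 ^ suc (2 ^ h))
  Word-↔ = Vec-↔ _ (↔-sym Fin.2↔Bool)

  𝔄 : Structure σ-coloured
  𝔄 = Paths id

  -- The path of w gets a second copy, indexed by nothing.
  𝔅 : Word → Structure σ-coloured
  𝔅 w = Paths (fromMaybe w)

  𝔄-finite : FiniteNonEmpty 𝔄
  𝔄-finite = Paths-finite id Word-↔ (replicate _ false)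

  𝔅-finite : ∀ w → FiniteNonEmpty (𝔅 w)
  𝔅-finite w = Paths-finite (fromMaybe w) (Maybe-↔ Word-↔) nothing

  module _ (w : Word) where

    relocate : Word → Maybe Word
    relocate v with v ≟W w
    ... | yes _ = nothing
    ... | no _ = just v

    fromMaybe-relocate : ∀ v → fromMaybe w (relocate v) ≡ v
    fromMaybe-relocate v with v ≟W w
    ... | yes v≡w = sym v≡w
    ... | no _ = refl

    relocate-self : relocate w ≡ nothing
    relocate-self with w ≟W w
    ... | yes _ = refl
    ... | no w≢w = ⊥-elim (w≢w refl)

    relocate-≢ : ∀ {v} → v ≢ w → relocate v ≡ just v
    relocate-≢ {v} v≢w with v ≟W w
    ... | yes v≡w = ⊥-elim (v≢w v≡w)
    ... | no _ = refl

    𝔅-covered : ∀ {n} (ρ : Fin n → Carrier 𝔄) → (∀ i → proj₁ (ρ i) ≢ w) → (b : Carrier (𝔅 w)) →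
      Σ (ComponentEmbedding 𝔄 (𝔅 w)) λ e → Σ (Carrier 𝔄) λ a → embed e a ≡ b × embed e ∘ ρ ≗ map₁ just ∘ ρ
    𝔅-covered ρ avoids-w (just v , p) =
      reindex just (fromMaybe w) (λ _ → refl) (λ _ → refl) , (v , p) , refl , λ _ → refl
    𝔅-covered ρ avoids-w (nothing , p) =
      reindex relocate (fromMaybe w) fromMaybe-relocate (λ _ → refl) , (w , p) ,
      cong (_, p) relocate-self , λ i → cong (_, proj₂ (ρ i)) (relocate-≢ (avoids-w i))

  Sat-exs-all-𝔅 : ∀ {n} r (φ : Formula σ-coloured (suc n)) → IsLocal r φ → n < 2 ^ suc (2 ^ h) →
    Sat 𝔄 (exs n (all φ)) ∅ → Σ Word λ w → Sat (𝔅 w) (exs n (all φ)) ∅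
  Sat-exs-all-𝔅 {n} r φ local n<#words 𝔄⊨θ =
    let ρ , 𝔄⊨∀φ = Sat-exs⁻ 𝔄 n (all φ) 𝔄⊨θ
        w , avoids-w = ∃-∉-image Word-↔ n<#words (proj₁ ∘ ρ)
    in w , Sat-exs⁺ (𝔅 w) n (all φ) (map₁ just ∘ ρ)
             (Sat-all-local-cover r φ local 𝔄-finite (𝔅-finite w) (Product.≡-dec _≟M_ Fin._≟_)
               ρ (map₁ just ∘ ρ) (𝔅-covered w ρ avoids-w) 𝔄⊨∀φ)

  BSNF-noTwins-size : (θ : Sentence σ-coloured) → BSNF θ → EquivOnDegree 2 (noTwins h) θ →
    2 ^ (2 ^ h + 1) < size θ
  BSNF-noTwins-size θ (n , φ , refl , r , local) equiv with 2 ^ (2 ^ h + 1) ≤? n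
  ... | yes many = ≤-<-trans many (<-≤-trans (m<m+n n z<s) (size-exs n (all φ)))
  ... | no few =
    let 𝔄⊨θ = Equivalence.to (equiv 𝔄 𝔄-finite (Paths-degree≤2 id)) (Paths-noTwins id h refl id)
        n<#words = subst (λ e → n < 2 ^ e) (+-comm (2 ^ h) 1) (≰⇒> few)
        w , 𝔅⊨θ = Sat-exs-all-𝔅 r φ local n<#words 𝔄⊨θ
        𝔅⊨noTwins = Equivalence.from (equiv (𝔅 w) (𝔅-finite w) (Paths-degree≤2 (fromMaybe w))) 𝔅⊨θ
    in ⊥-elim (Paths-¬noTwins (fromMaybe w) _≟M_ h refl {just w} {nothing} (λ ()) refl 𝔅⊨noTwins)

theorem12 : Σ Signature λ σ → Σ (ℕ → Sentence σ) λ φ →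
    (Σ ℕ λ C → (h : ℕ) → 1 ≤ h → size (φ h) ≤ C * h) ×
    ((h : ℕ) → 1 ≤ h → (θ : Sentence σ) → BSNF θ → EquivOnDegree 2 (φ h) θ →
      2 ^ (2 ^ h + 1) < size θ)
theorem12 = σ-coloured , noTwins , (130 , size-noTwins) , λ h _ → BSNF-noTwins-size h
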